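{- Let $K\ge1$ be an integer and let $p$ be an odd prime. If $q$ is a prime with $q\mid \pi_K(p)$, then $q\le p$, and equality $q=p$ can hold only if $p\mid K^2+4$.
   Context: The $K$-Fibonacci sequence is $F_{K,0}=0$, $F_{K,1}=1$, $F_{K,n}=K F_{K,n-1}+F_{K,n-2}$; for an integer $m>1$, $\pi_K(m)$ is the length of its shortest period modulo $m$. -}

module Defs where

open import Data.Nat using (ℕ; zero; suc; _+_; _*_; _<_; _%_; NonZero)
open import Relation.Binary.PropositionalEquality using (_≡_)
open import Data.Product using (_×_)

KFib : ℕ → ℕ → ℕ
KFib K zero = 0
KFib K (suc zero) = 1
KFib K (suc (suc n)) = K * KFib K (suc n) + KFib K n

IsPeriodMod : ℕ → (m : ℕ) → .{{NonZero m}} → ℕ → Set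
IsPeriodMod K m t = ∀ n → KFib K (n + t) % m ≡ KFib K n % m

IsPisano : ℕ → (m : ℕ) → .{{NonZero m}} → ℕ → Set
IsPisano K m t =
  (0 < t) × IsPeriodMod K m t × (∀ s → 0 < s → IsPeriodMod K m s → t Data.Nat.≤ s)

{-# OPTIONS --safe #-}
module Submission where

-- Work in R = (ℤ/p)[α] with α² = Kα + 1. There α^n = F_{n-1} + F_n α, so α^N = 1 makes N a
-- period, hence a multiple of π_K(p). Put s = 2α − K, so s² = D = K² + 4, and let φ(x) = x^p
-- be the Frobenius endomorphism of R; it fixes ℤ/p and φ(s) = D^((p−1)/2) s.
-- If p ∣ D then φ(s) = 0, so φ(α) = K/2 is fixed by φ and α^(p(p−1)) = 1.
-- Otherwise D^(p−1) = 1 gives φ²(s) = s, hence φ²(α) = α and α^(p²−1) = 1.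
-- Prime factors of p(p − 1) are at most p, and those of p² − 1 = (p − 1)·2·((p + 1)/2) are below p.

open import Defs
open import Level using (0ℓ)
open import Data.Nat.Base as ℕ using (ℕ; zero; suc; NonZero; _≤_; _<_; z≤n; s≤s; z<s; s<s)
import Data.Nat.Properties as ℕ
open import Data.Nat.DivMod using ([m+kn]%n≡m%n; m/n*n≡m; %-distribˡ-+; %-distribˡ-*; m≡m%n+[m/n]*n; m%n<n)
open import Data.Nat.Divisibility using (_∣_; divides; ∣⇒≤; ∣-trans; ∣1⇒≡1; m∣m*n; m%n≡0⇒n∣m)
open import Data.Nat.Primality using (Prime; euclidsLemma; prime⇒irreducible; prime⇒nonZero; ¬prime[1])
open import Data.Nat.Coprimality using (Coprime; coprime-Bézout)
open import Data.Nat.GCD using (module Bézout)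
open import Data.Nat.Combinatorics using (_C_; nCn≡1; k![n∸k]!∣n!)
open import Data.Nat.Combinatorics.Specification using (nCk≡n!/k![n-k]!)
open import Data.Nat.Tactic.RingSolver using (solve)
open import Data.List.Base using (_∷_; [])
open import Data.Product using (_,_; ∃-syntax)
open import Data.Sum using (_⊎_; inj₁; inj₂)
open import Function.Base using (_∘_)
open import Relation.Binary.PropositionalEquality as ≡ using (_≡_; _≢_)
open import Relation.Binary.Structures using (IsEquivalence)
open import Relation.Nullary using (¬_; contradiction)
open import Algebra.Bundles using (CommutativeSemiring)

module _ where

  open import Data.Nat.Base using (_*_; _∸_; _%_; _/_; _!)

  prime∣*⇒≤⊎≤ : ∀ {q m n} .{{_ : NonZero m}} .{{_ : NonZero n}} →
                 Prime q → q ∣ m * n → q ≤ m ⊎ q ≤ n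
  prime∣*⇒≤⊎≤ {m = m} {n} q-prime q∣mn with euclidsLemma m n q-prime q∣mn
  ... | inj₁ q∣m = inj₁ (∣⇒≤ q∣m)
  ... | inj₂ q∣n = inj₂ (∣⇒≤ q∣n)

  n∣n! : ∀ n .{{_ : NonZero n}} → n ∣ n !
  n∣n! (suc n) = m∣m*n (n !)

  prime∤! : ∀ {p} n → Prime p → n < p → ¬ p ∣ n !
  prime∤! zero    p-prime _ p∣1 = ¬prime[1] (≡.subst Prime (∣1⇒≡1 p∣1) p-prime)
  prime∤! (suc n) p-prime n<p p∣n! with euclidsLemma (suc n) (n !) p-prime p∣n!
  ... | inj₁ p∣1+n = ℕ.<⇒≱ n<p (∣⇒≤ p∣1+n)
  ... | inj₂ p∣n!  = prime∤! n p-prime (ℕ.<-trans (ℕ.n<1+n n) n<p) p∣n!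

  -- p! = (p C k) k! (p − k)!, and p divides the left side but neither factorial.
  prime∣C : ∀ {p k} → Prime p → 0 < k → k < p → p ∣ p C k
  prime∣C {p} {k} p-prime 0<k k<p with euclidsLemma (p C k) (k ! * (p ∸ k) !) p-prime p∣C*d
    where
    instance
      _ = prime⇒nonZero p-prime
      _ = k ℕ.!* (p ∸ k) !≢0
    C*d≡p! : (p C k) * (k ! * (p ∸ k) !) ≡ p !
    C*d≡p! = ≡.trans (≡.cong (_* (k ! * (p ∸ k) !)) (nCk≡n!/k![n-k]! (ℕ.<⇒≤ k<p)))
                     (m/n*n≡m (k![n∸k]!∣n! (ℕ.<⇒≤ k<p)))
    p∣C*d : p ∣ (p C k) * (k ! * (p ∸ k) !)
    p∣C*d = ≡.subst (p ∣_) (≡.sym C*d≡p!) (n∣n! p)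
  ... | inj₁ p∣C = p∣C
  ... | inj₂ p∣k![p∸k]! with euclidsLemma (k !) ((p ∸ k) !) p-prime p∣k![p∸k]!
  ...   | inj₁ p∣k!     = contradiction p∣k! (prime∤! k p-prime k<p)
  ...   | inj₂ p∣[p∸k]! = contradiction p∣[p∸k]! (prime∤! (p ∸ k) p-prime p∸k<p)
    where
    p∸k<p : p ∸ k < p
    p∸k<p = ℕ.∸-monoʳ-< {p} {k} {0} 0<k (ℕ.<⇒≤ k<p)

  prime≢2⇒odd : ∀ {p} → Prime p → 2 ≢ p → ∃[ h ] p ≡ suc (2 * h)
  prime≢2⇒odd {p} p-prime 2≢p with p % 2 | m≡m%n+[m/n]*n p 2 | m%n<n p 2
  ... | 0           | p≡[p/2]*2   | _ = contradiction (divides (p / 2) p≡[p/2]*2) 2∤p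
    where
    2∤p : ¬ 2 ∣ p
    2∤p 2∣p with prime⇒irreducible p-prime 2∣p
    ... | inj₂ 2≡p = 2≢p 2≡p
  ... | 1           | p≡1+[p/2]*2 | _ = p / 2 , ≡.trans p≡1+[p/2]*2 (≡.cong suc (ℕ.*-comm (p / 2) 2))
  ... | suc (suc _) | _           | s<s (s<s ())

  prime[1+2h]⇒nonZero : ∀ {h} → Prime (suc (2 * h)) → NonZero h
  prime[1+2h]⇒nonZero {suc h} _ = _

  module _ {h : ℕ} .{{_ : NonZero h}} where

    prime∣p[p∸1]⇒≤p : ∀ {q} → Prime q → q ∣ suc (2 * h) * (2 * h) → q ≤ suc (2 * h)
    prime∣p[p∸1]⇒≤p q-prime q∣N with prime∣*⇒≤⊎≤ {{_}} {{ℕ.m*n≢0 2 h}} q-prime q∣N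
    ... | inj₁ q≤p  = q≤p
    ... | inj₂ q≤2h = ℕ.m≤n⇒m≤1+n q≤2h

    1+h<p : suc h < suc (2 * h)
    1+h<p = s≤s (≡.subst (h <_) (ℕ.*-comm h 2) (ℕ.m<m*n h 2 (s≤s (s≤s z≤n))))

    prime∣p²∸1⇒<p : ∀ {q} → Prime q → q ∣ 2 * h * (2 * suc h) → q < suc (2 * h)
    prime∣p²∸1⇒<p q-prime q∣N with euclidsLemma (2 * h) (2 * suc h) q-prime q∣N
    ... | inj₁ q∣2h = s≤s (∣⇒≤ {{ℕ.m*n≢0 2 h}} q∣2h)
    ... | inj₂ q∣2[1+h] with prime∣*⇒≤⊎≤ q-prime q∣2[1+h]
    ...   | inj₁ q≤2   = ℕ.≤-<-trans (ℕ.≤-trans q≤2 (s≤s (ℕ.>-nonZero⁻¹ h))) 1+h<p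
    ...   | inj₂ q≤1+h = ℕ.≤-<-trans q≤1+h 1+h<p

module Modular (m : ℕ) .{{_ : NonZero m}} where

  open import Data.Nat.Base using (_+_; _*_; _%_)
  open ≡.≡-Reasoning

  infix 4 _≡ₘ_
  record _≡ₘ_ (a b : ℕ) : Set where
    constructor from-%
    field to-% : a % m ≡ b % m

  open _≡ₘ_ public

  ≡ₘ-reflexive : ∀ {a b} → a ≡ b → a ≡ₘ b
  ≡ₘ-reflexive a≡b = from-% (≡.cong (_% m) a≡b)

  ≡ₘ-isEquivalence : IsEquivalence _≡ₘ_
  ≡ₘ-isEquivalence = record
    { refl  = from-% ≡.refl
    ; sym   = λ a≡b → from-% (≡.sym (to-% a≡b))
    ; trans = λ a≡b b≡c → from-% (≡.trans (to-% a≡b) (to-% b≡c))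
    }

  ≡ₘ-by-multiples : ∀ {a b} i j → a + i * m ≡ b + j * m → a ≡ₘ b
  ≡ₘ-by-multiples {a} {b} i j eq = from-% (begin
    a % m             ≡⟨ [m+kn]%n≡m%n a i m ⟨
    (a + i * m) % m   ≡⟨ ≡.cong (_% m) eq ⟩
    (b + j * m) % m   ≡⟨ [m+kn]%n≡m%n b j m ⟩
    b % m             ∎)

  +-congₘ : ∀ {a a′ b b′} → a ≡ₘ a′ → b ≡ₘ b′ → a + b ≡ₘ a′ + b′
  +-congₘ {a} {a′} {b} {b′} (from-% a≡a′) (from-% b≡b′) = from-% (begin
    (a + b) % m             ≡⟨ %-distribˡ-+ a b m ⟩
    (a % m + b % m) % m     ≡⟨ ≡.cong₂ (λ x y → (x + y) % m) a≡a′ b≡b′ ⟩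
    (a′ % m + b′ % m) % m   ≡⟨ %-distribˡ-+ a′ b′ m ⟨
    (a′ + b′) % m           ∎)

  *-congₘ : ∀ {a a′ b b′} → a ≡ₘ a′ → b ≡ₘ b′ → a * b ≡ₘ a′ * b′
  *-congₘ {a} {a′} {b} {b′} (from-% a≡a′) (from-% b≡b′) = from-% (begin
    (a * b) % m             ≡⟨ %-distribˡ-* a b m ⟩
    (a % m * (b % m)) % m   ≡⟨ ≡.cong₂ (λ x y → (x * y) % m) a≡a′ b≡b′ ⟩
    (a′ % m * (b′ % m)) % m ≡⟨ %-distribˡ-* a′ b′ m ⟨
    (a′ * b′) % m           ∎)

  -- In the second Bézout case x a ≡ −1, so (x a)² ≡ 1 gives an inverse without subtraction.
  mod-inverse : ∀ {a} → Prime m → ¬ m ∣ a → ∃[ u ] u * a ≡ₘ 1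
  mod-inverse {a} m-prime m∤a with coprime-Bézout a-coprime-m
    where
    a-coprime-m : Coprime a m
    a-coprime-m (d∣a , d∣m) with prime⇒irreducible m-prime d∣m
    ... | inj₁ d≡1   = d≡1
    ... | inj₂ ≡.refl = contradiction d∣a m∤a
  ... | Bézout.+- x y 1+ym≡xa =
    x , ≡ₘ-by-multiples 0 y (≡.trans (ℕ.+-identityʳ (x * a)) (≡.sym 1+ym≡xa))
  ... | Bézout.-+ x y 1+xa≡ym = x * x * a , ≡ₘ-by-multiples (2 * y) (y * y * m) (begin
    x * x * a * a + 2 * y * m            ≡⟨ solve (x ∷ y ∷ a ∷ m ∷ []) ⟩
    (x * a) * (x * a) + 2 * (y * m)      ≡⟨ ≡.cong (λ v → (x * a) * (x * a) + 2 * v) 1+xa≡ym ⟨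
    (x * a) * (x * a) + 2 * (1 + x * a)  ≡⟨ solve (x ∷ a ∷ []) ⟩
    1 + (1 + x * a) * (1 + x * a)        ≡⟨ ≡.cong (λ v → 1 + v * v) 1+xa≡ym ⟩
    1 + (y * m) * (y * m)                ≡⟨ solve (y ∷ m ∷ []) ⟩
    1 + y * y * m * m                    ∎)

module _ {K m : ℕ} .{{_ : NonZero m}} where

  open import Data.Nat.Base using (_+_; _*_; _%_; _/_)
  open ≡.≡-Reasoning

  IsPeriodMod-* : ∀ {t} → IsPeriodMod K m t → ∀ c → IsPeriodMod K m (c * t)
  IsPeriodMod-* t-period zero    n = ≡.cong (λ i → KFib K i % m) (ℕ.+-identityʳ n)
  IsPeriodMod-* {t} t-period (suc c) n = begin
    KFib K (n + (t + c * t)) % m  ≡⟨ ≡.cong (λ i → KFib K i % m) (ℕ.+-assoc n t (c * t)) ⟨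
    KFib K (n + t + c * t) % m    ≡⟨ IsPeriodMod-* t-period c (n + t) ⟩
    KFib K (n + t) % m            ≡⟨ t-period n ⟩
    KFib K n % m                  ∎

  pisano∣period : ∀ {t N} → IsPisano K m t → IsPeriodMod K m N → t ∣ N
  pisano∣period {t} {N} (t>0 , t-period , t-minimal) N-period = m%n≡0⇒n∣m N t N%t≡0
    where
    instance _ = ℕ.>-nonZero t>0

    remainder-period : IsPeriodMod K m (N % t)
    remainder-period n = begin
      KFib K (n + N % t) % m                ≡⟨ IsPeriodMod-* t-period (N / t) (n + N % t) ⟨
      KFib K (n + N % t + N / t * t) % m    ≡⟨ ≡.cong (λ i → KFib K i % m) (ℕ.+-assoc n _ _) ⟩
      KFib K (n + (N % t + N / t * t)) % m  ≡⟨ ≡.cong (λ i → KFib K (n + i) % m) (m≡m%n+[m/n]*n N t) ⟨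
      KFib K (n + N) % m                    ≡⟨ N-period n ⟩
      KFib K n % m                          ∎

    N%t≡0 : N % t ≡ 0
    N%t≡0 with N % t | remainder-period | m%n<n N t
    ... | zero  | _        | _   = ≡.refl
    ... | suc r | r-period | r<t = contradiction (t-minimal (suc r) z<s r-period) (ℕ.<⇒≱ r<t)

module CommutativeSemiringProperties {c ℓ} (R : CommutativeSemiring c ℓ) where

  open import Data.Nat.Base using (_%_; _/_)
  open import Data.Fin.Base using (zero; suc; toℕ; fromℕ; inject₁)
  open import Data.Fin.Properties using (toℕ-fromℕ; toℕ-inject₁; toℕ<n)
  open CommutativeSemiring R hiding (zero)
  open import Algebra.Properties.Semiring.Exp semiring using (_^_; ^-congˡ; ^-congʳ; ^-homo-*; ^-assocʳ)
  open import Algebra.Properties.CommutativeSemiring.Exp R using (^-distrib-*)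
  open import Algebra.Properties.Monoid.Mult +-monoid using (_×_; ×-homo-1; ×-homo-+; ×-congˡ; ×-congʳ)
  open import Algebra.Properties.Semiring.Mult semiring using (×1-homo-*; ×-assoc-*)
  open import Algebra.Properties.Monoid.Sum +-monoid using (sum; sum-init-last; sum-cong-≋; sum-replicate-zero)
  open import Algebra.Properties.CommutativeSemiring.Binomial R using (theorem; binomialTerm)
  open import Relation.Binary.Reasoning.Setoid setoid

  ι : ℕ → Carrier
  ι n = n × 1#

  ι-homo-^ : ∀ n k → ι n ^ k ≈ ι (n ℕ.^ k)
  ι-homo-^ n zero    = sym (+-identityʳ 1#)
  ι-homo-^ n (suc k) = trans (*-congˡ (ι-homo-^ n k)) (sym (×1-homo-* n (n ℕ.^ k)))

  1#^n≈1# : ∀ n → 1# ^ n ≈ 1#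
  1#^n≈1# zero    = refl
  1#^n≈1# (suc n) = trans (*-identityˡ (1# ^ n)) (1#^n≈1# n)

  0#^n≈0# : ∀ n .{{_ : NonZero n}} → 0# ^ n ≈ 0#
  0#^n≈0# (suc n) = zeroˡ (0# ^ n)

  *-cancelˡ-unit : ∀ {u x y z} → u * x ≈ 1# → x * y ≈ x * z → y ≈ z
  *-cancelˡ-unit {u} {x} {y} {z} ux≈1 xy≈xz = begin
    y             ≈⟨ *-identityˡ y ⟨
    1# * y        ≈⟨ *-congʳ ux≈1 ⟨
    (u * x) * y   ≈⟨ *-assoc u x y ⟩
    u * (x * y)   ≈⟨ *-congˡ xy≈xz ⟩
    u * (x * z)   ≈⟨ *-assoc u x z ⟨
    (u * x) * z   ≈⟨ *-congʳ ux≈1 ⟩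
    1# * z        ≈⟨ *-identityˡ z ⟩
    z             ∎

  ^-unit : ∀ {u x} n → u * x ≈ 1# → u ^ n * x ^ n ≈ 1#
  ^-unit {u} {x} n ux≈1 = begin
    u ^ n * x ^ n ≈⟨ ^-distrib-* u x n ⟨
    (u * x) ^ n   ≈⟨ ^-congˡ n ux≈1 ⟩
    1# ^ n        ≈⟨ 1#^n≈1# n ⟩
    1#            ∎

  ^-cancel : ∀ {u x} m n → u * x ≈ 1# → x ^ (m ℕ.+ n) ≈ x ^ m → x ^ n ≈ 1#
  ^-cancel {u} {x} m n ux≈1 x^[m+n]≈x^m = *-cancelˡ-unit (^-unit m ux≈1) (begin
    x ^ m * x ^ n  ≈⟨ ^-homo-* x m n ⟨
    x ^ (m ℕ.+ n)  ≈⟨ x^[m+n]≈x^m ⟩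
    x ^ m          ≈⟨ *-identityʳ (x ^ m) ⟨
    x ^ m * 1#     ∎)

  ^-odd : ∀ {s d} h → s * s ≈ d → s ^ suc (2 ℕ.* h) ≈ s * d ^ h
  ^-odd {s} {d} h s²≈d = *-congˡ (begin
    s ^ (2 ℕ.* h)  ≈⟨ ^-assocʳ s 2 h ⟨
    (s ^ 2) ^ h    ≈⟨ ^-congˡ h (*-congˡ (*-identityʳ s)) ⟩
    (s * s) ^ h    ≈⟨ ^-congˡ h s²≈d ⟩
    d ^ h          ∎)

  module Characteristic {p} (p-prime : Prime p) (char : ι p ≈ 0#) where

    instance _ = prime⇒nonZero p-prime

    ι-vanishes : ∀ {n} → p ∣ n → ι n ≈ 0#
    ι-vanishes (divides k ≡.refl) = begin
      ι (k ℕ.* p)  ≈⟨ ×1-homo-* k p ⟩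
      ι k * ι p    ≈⟨ *-congˡ char ⟩
      ι k * 0#     ≈⟨ zeroʳ (ι k) ⟩
      0#           ∎

    ×-vanishes : ∀ {n} x → p ∣ n → n × x ≈ 0#
    ×-vanishes {n} x p∣n = begin
      n × x        ≈⟨ ×-congʳ n (*-identityˡ x) ⟨
      n × (1# * x) ≈⟨ ×-assoc-* n 1# x ⟨
      ι n * x      ≈⟨ *-congʳ (ι-vanishes p∣n) ⟩
      0# * x       ≈⟨ zeroˡ x ⟩
      0#           ∎

    open Modular p using (_≡ₘ_; to-%; mod-inverse)

    ι-cong-mod : ∀ {a b} → a ≡ₘ b → ι a ≈ ι b
    ι-cong-mod {a} {b} a≡b = begin
      ι a                          ≡⟨ ≡.cong ι (m≡m%n+[m/n]*n a p) ⟩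
      ι (a % p ℕ.+ a / p ℕ.* p)    ≈⟨ drop-multiple a ⟩
      ι (a % p)                    ≡⟨ ≡.cong ι (to-% a≡b) ⟩
      ι (b % p)                    ≈⟨ drop-multiple b ⟨
      ι (b % p ℕ.+ b / p ℕ.* p)    ≡⟨ ≡.cong ι (m≡m%n+[m/n]*n b p) ⟨
      ι b                          ∎
      where
      drop-multiple : ∀ n → ι (n % p ℕ.+ n / p ℕ.* p) ≈ ι (n % p)
      drop-multiple n = begin
        ι (n % p ℕ.+ n / p ℕ.* p)  ≈⟨ ×-homo-+ 1# (n % p) (n / p ℕ.* p) ⟩
        ι (n % p) + ι (n / p ℕ.* p) ≈⟨ +-congˡ (ι-vanishes (divides (n / p) ≡.refl)) ⟩
        ι (n % p) + 0#              ≈⟨ +-identityʳ (ι (n % p)) ⟩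
        ι (n % p)                   ∎

    frobenius-+ : ∀ x y → (x + y) ^ p ≈ x ^ p + y ^ p
    frobenius-+ x y = expand (ℕ.pred p) (ℕ.suc-pred p)
      where
      expand : ∀ n → suc n ≡ p → (x + y) ^ p ≈ x ^ p + y ^ p
      expand n ≡.refl = begin
        (x + y) ^ p                                ≈⟨ theorem p x y ⟩
        t zero + sum (t ∘ suc)                     ≈⟨ +-congˡ (sum-init-last (t ∘ suc)) ⟩
        t zero + (sum (t ∘ suc ∘ inject₁) + t (suc (fromℕ n)))
                                                   ≈⟨ +-cong first-term (+-cong middle-terms last-term) ⟩
        y ^ p + (0# + x ^ p)                       ≈⟨ +-congˡ (+-identityˡ (x ^ p)) ⟩
        y ^ p + x ^ p                              ≈⟨ +-comm (y ^ p) (x ^ p) ⟩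
        x ^ p + y ^ p                              ∎
        where
        t = binomialTerm x y p

        first-term : t zero ≈ y ^ p
        first-term = trans (×-homo-1 (1# * y ^ p)) (*-identityˡ (y ^ p))

        middle-terms : sum (t ∘ suc ∘ inject₁) ≈ 0#
        middle-terms = trans (sum-cong-≋ vanishes) (sum-replicate-zero n)
          where
          vanishes : ∀ i → t (suc (inject₁ i)) ≈ 0#
          vanishes i = ×-vanishes _ (prime∣C p-prime z<s (s<s i<n))
            where
            i<n : toℕ (inject₁ i) < n
            i<n = ≡.subst (_< n) (≡.sym (toℕ-inject₁ i)) (toℕ<n i)

        last-term : t (suc (fromℕ n)) ≈ x ^ p
        last-term rewrite toℕ-fromℕ n = begin
          (p C p) × (x ^ p * y ^ (p ℕ.∸ p)) ≈⟨ ×-congˡ (nCn≡1 p) ⟩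
          1 × (x ^ p * y ^ (p ℕ.∸ p))       ≈⟨ ×-homo-1 _ ⟩
          x ^ p * y ^ (p ℕ.∸ p)             ≈⟨ *-congˡ (^-congʳ y (ℕ.n∸n≡0 p)) ⟩
          x ^ p * 1#                        ≈⟨ *-identityʳ (x ^ p) ⟩
          x ^ p                             ∎

    fermat : ∀ n → ι n ^ p ≈ ι n
    fermat zero    = 0#^n≈0# p
    fermat (suc n) = begin
      (1# + ι n) ^ p     ≈⟨ frobenius-+ 1# (ι n) ⟩
      1# ^ p + ι n ^ p   ≈⟨ +-cong (1#^n≈1# p) (fermat n) ⟩
      1# + ι n           ∎

    ι-unit : ∀ {a} → ¬ p ∣ a → ∃[ u ] ι u * ι a ≈ 1#
    ι-unit {a} p∤a with mod-inverse p-prime p∤a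
    ... | u , ua≡1 = u , (begin
      ι u * ι a    ≈⟨ ×1-homo-* u a ⟨
      ι (u ℕ.* a)  ≈⟨ ι-cong-mod ua≡1 ⟩
      ι 1          ≈⟨ +-identityʳ 1# ⟩
      1#           ∎)

-- (ℤ/m)[α]/(α² − Kα − 1): ⟨ a , b ⟩ stands for a + bα, both coordinates compared modulo m.
module KFibRing (K m : ℕ) .{{_ : NonZero m}} where

  open import Data.Nat.Base using (_+_; _*_)
  open import Data.Product using (_×_)
  open import Algebra.Structures using (IsCommutativeSemiring; IsMagma)
  open import Algebra.Definitions using (Congruent₂)
  open Modular m

  data Carrier : Set where
    ⟨_,_⟩ : ℕ → ℕ → Carrier

  infix 4 _≈_
  infixl 6 _⊕_
  infixl 7 _⊛_

  _≈_ : Carrier → Carrier → Set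
  ⟨ a , b ⟩ ≈ ⟨ c , d ⟩ = a ≡ₘ c × b ≡ₘ d

  _⊕_ : Carrier → Carrier → Carrier
  ⟨ a , b ⟩ ⊕ ⟨ c , d ⟩ = ⟨ a + c , b + d ⟩

  _⊛_ : Carrier → Carrier → Carrier
  ⟨ a , b ⟩ ⊛ ⟨ c , d ⟩ = ⟨ a * c + b * d , a * d + b * c + K * (b * d) ⟩

  𝟎 𝟏 α : Carrier
  𝟎 = ⟨ 0 , 0 ⟩
  𝟏 = ⟨ 1 , 0 ⟩
  α = ⟨ 0 , 1 ⟩

  ≡⇒≈ : ∀ {x y} → x ≡ y → x ≈ y
  ≡⇒≈ {⟨ a , b ⟩} ≡.refl = ≡ₘ-reflexive ≡.refl , ≡ₘ-reflexive ≡.refl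

  ≈-isEquivalence : IsEquivalence _≈_
  ≈-isEquivalence = record
    { refl  = λ { {⟨ _ , _ ⟩} → ≡ₘ.refl , ≡ₘ.refl }
    ; sym   = λ { {⟨ _ , _ ⟩} {⟨ _ , _ ⟩} (a≡ , b≡) → ≡ₘ.sym a≡ , ≡ₘ.sym b≡ }
    ; trans = λ { {⟨ _ , _ ⟩} {⟨ _ , _ ⟩} {⟨ _ , _ ⟩} (a≡ , b≡) (c≡ , d≡) →
                    ≡ₘ.trans a≡ c≡ , ≡ₘ.trans b≡ d≡ }
    }
    where module ≡ₘ = IsEquivalence ≡ₘ-isEquivalence

  ⊕-cong : ∀ {x x′ y y′} → x ≈ x′ → y ≈ y′ → x ⊕ y ≈ x′ ⊕ y′
  ⊕-cong {⟨ _ , _ ⟩} {⟨ _ , _ ⟩} {⟨ _ , _ ⟩} {⟨ _ , _ ⟩} (a≡ , b≡) (c≡ , d≡) =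
    +-congₘ a≡ c≡ , +-congₘ b≡ d≡

  ⊛-cong : ∀ {x x′ y y′} → x ≈ x′ → y ≈ y′ → x ⊛ y ≈ x′ ⊛ y′
  ⊛-cong {⟨ _ , _ ⟩} {⟨ _ , _ ⟩} {⟨ _ , _ ⟩} {⟨ _ , _ ⟩} (a≡ , b≡) (c≡ , d≡) =
    +-congₘ (*-congₘ a≡ c≡) (*-congₘ b≡ d≡) ,
    +-congₘ (+-congₘ (*-congₘ a≡ d≡) (*-congₘ b≡ c≡))
            (*-congₘ (≡ₘ-reflexive {K} ≡.refl) (*-congₘ b≡ d≡))

  ⊕-assoc : ∀ x y z → (x ⊕ y) ⊕ z ≡ x ⊕ (y ⊕ z)
  ⊕-assoc ⟨ a , b ⟩ ⟨ c , d ⟩ ⟨ e , f ⟩ =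
    ≡.cong₂ ⟨_,_⟩ (ℕ.+-assoc a c e) (ℕ.+-assoc b d f)

  ⊕-comm : ∀ x y → x ⊕ y ≡ y ⊕ x
  ⊕-comm ⟨ a , b ⟩ ⟨ c , d ⟩ = ≡.cong₂ ⟨_,_⟩ (ℕ.+-comm a c) (ℕ.+-comm b d)

  ⊕-identityˡ : ∀ x → 𝟎 ⊕ x ≡ x
  ⊕-identityˡ ⟨ a , b ⟩ = ≡.refl

  ⊛-assoc : ∀ x y z → (x ⊛ y) ⊛ z ≡ x ⊛ (y ⊛ z)
  ⊛-assoc ⟨ a , b ⟩ ⟨ c , d ⟩ ⟨ e , f ⟩ =
    ≡.cong₂ ⟨_,_⟩ (solve (K ∷ a ∷ b ∷ c ∷ d ∷ e ∷ f ∷ []))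
                  (solve (K ∷ a ∷ b ∷ c ∷ d ∷ e ∷ f ∷ []))

  ⊛-comm : ∀ x y → x ⊛ y ≡ y ⊛ x
  ⊛-comm ⟨ a , b ⟩ ⟨ c , d ⟩ =
    ≡.cong₂ ⟨_,_⟩ (solve (a ∷ b ∷ c ∷ d ∷ [])) (solve (K ∷ a ∷ b ∷ c ∷ d ∷ []))

  ⊛-identityˡ : ∀ x → 𝟏 ⊛ x ≡ x
  ⊛-identityˡ ⟨ a , b ⟩ = ≡.cong₂ ⟨_,_⟩ (solve (a ∷ b ∷ [])) (solve (K ∷ a ∷ b ∷ []))

  ⊛-distribʳ-⊕ : ∀ x y z → (y ⊕ z) ⊛ x ≡ y ⊛ x ⊕ z ⊛ x
  ⊛-distribʳ-⊕ ⟨ a , b ⟩ ⟨ c , d ⟩ ⟨ e , f ⟩ =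
    ≡.cong₂ ⟨_,_⟩ (solve (a ∷ b ∷ c ∷ d ∷ e ∷ f ∷ []))
                  (solve (K ∷ a ∷ b ∷ c ∷ d ∷ e ∷ f ∷ []))

  ⊛-zeroˡ : ∀ x → 𝟎 ⊛ x ≡ 𝟎
  ⊛-zeroˡ ⟨ a , b ⟩ = ≡.cong₂ ⟨_,_⟩ ≡.refl (ℕ.*-zeroʳ K)

  isCommutativeSemiring : IsCommutativeSemiring _≈_ _⊕_ _⊛_ 𝟎 𝟏
  isCommutativeSemiring = isCommutativeSemiringˡ record
    { +-isCommutativeMonoid = isCommutativeMonoidˡ record
      { isSemigroup = record { isMagma = isMagma ⊕-cong ; assoc = λ x y z → ≡⇒≈ (⊕-assoc x y z) }
      ; identityˡ   = λ x → ≡⇒≈ (⊕-identityˡ x)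
      ; comm        = λ x y → ≡⇒≈ (⊕-comm x y)
      }
    ; *-isCommutativeMonoid = isCommutativeMonoidˡ record
      { isSemigroup = record { isMagma = isMagma ⊛-cong ; assoc = λ x y z → ≡⇒≈ (⊛-assoc x y z) }
      ; identityˡ   = λ x → ≡⇒≈ (⊛-identityˡ x)
      ; comm        = λ x y → ≡⇒≈ (⊛-comm x y)
      }
    ; distribʳ = λ x y z → ≡⇒≈ (⊛-distribʳ-⊕ x y z)
    ; zeroˡ    = λ x → ≡⇒≈ (⊛-zeroˡ x)
    }
    where
    open import Algebra.Structures.Biased _≈_ using (isCommutativeSemiringˡ; isCommutativeMonoidˡ)
    isMagma : ∀ {∙} → Congruent₂ _≈_ ∙ → IsMagma _≈_ ∙
    isMagma ∙-cong = record { isEquivalence = ≈-isEquivalence ; ∙-cong = ∙-cong }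

  commutativeSemiring : CommutativeSemiring 0ℓ 0ℓ
  commutativeSemiring = record { isCommutativeSemiring = isCommutativeSemiring }

  open CommutativeSemiring commutativeSemiring using (semiring; setoid; *-congˡ; *-identityʳ)
  open import Algebra.Properties.Semiring.Exp semiring using (_^_; ^-homo-*)
  open CommutativeSemiringProperties commutativeSemiring using (ι)

  ι≡ : ∀ n → ι n ≡ ⟨ n , 0 ⟩
  ι≡ zero    = ≡.refl
  ι≡ (suc n) = ≡.cong (𝟏 ⊕_) (ι≡ n)

  characteristic : ι m ≈ 𝟎
  characteristic rewrite ι≡ m = ≡ₘ-by-multiples 0 1 ≡.refl , ≡ₘ-reflexive ≡.refl

  -- α⁻¹ = α − K, because α² − Kα = 1; the constant (m − 1) K stands for −K.
  α⁻¹ : Carrier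
  α⁻¹ = ⟨ ℕ.pred m * K , 1 ⟩

  α⁻¹⊛α≈𝟏 : α⁻¹ ⊛ α ≈ 𝟏
  α⁻¹⊛α≈𝟏 = ≡ₘ-reflexive (coefficient₀ (ℕ.pred m)) , ≡ₘ-by-multiples 0 K (begin
    ℕ.pred m * K * 1 + 1 * 0 + K * (1 * 1) + 0 * m ≡⟨ coefficient₁ (ℕ.pred m) ⟩
    K * suc (ℕ.pred m)                              ≡⟨ ≡.cong (K *_) (ℕ.suc-pred m) ⟩
    K * m                                           ∎)
    where
    open ≡.≡-Reasoning
    coefficient₀ : ∀ n → n * K * 0 + 1 * 1 ≡ 1
    coefficient₀ n = solve (n ∷ K ∷ [])
    coefficient₁ : ∀ n → n * K * 1 + 1 * 0 + K * (1 * 1) + 0 * m ≡ K * suc n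
    coefficient₁ n = solve (n ∷ K ∷ m ∷ [])

  α^suc : ∀ n → α ^ suc n ≡ ⟨ KFib K n , KFib K (suc n) ⟩
  α^suc zero    = ≡.cong₂ ⟨_,_⟩ ≡.refl (solve (K ∷ []))
  α^suc (suc n) = ≡.trans (≡.cong (α ⊛_) (α^suc n)) (α⊛ (KFib K n) (KFib K (suc n)))
    where
    α⊛ : ∀ a b → α ⊛ ⟨ a , b ⟩ ≡ ⟨ b , K * b + a ⟩
    α⊛ a b = ≡.cong₂ ⟨_,_⟩ (solve (a ∷ b ∷ [])) (solve (K ∷ a ∷ b ∷ []))

  α-coefficient : Carrier → ℕ
  α-coefficient ⟨ _ , b ⟩ = b

  α-coefficient-α^ : ∀ n → α-coefficient (α ^ n) ≡ KFib K n
  α-coefficient-α^ zero    = ≡.refl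
  α-coefficient-α^ (suc n) = ≡.cong α-coefficient (α^suc n)

  ≈⇒α-coefficient≡ₘ : ∀ {x y} → x ≈ y → α-coefficient x ≡ₘ α-coefficient y
  ≈⇒α-coefficient≡ₘ {⟨ _ , _ ⟩} {⟨ _ , _ ⟩} (_ , b≡d) = b≡d

  α^N≈𝟏⇒period : ∀ {N} → α ^ N ≈ 𝟏 → IsPeriodMod K m N
  α^N≈𝟏⇒period {N} α^N≈𝟏 n = to-% (
    ≡.subst₂ _≡ₘ_ (α-coefficient-α^ (n + N)) (α-coefficient-α^ n) (≈⇒α-coefficient≡ₘ (begin
      α ^ (n + N)     ≈⟨ ^-homo-* α n N ⟩
      α ^ n ⊛ α ^ N   ≈⟨ *-congˡ α^N≈𝟏 ⟩
      α ^ n ⊛ 𝟏       ≈⟨ *-identityʳ (α ^ n) ⟩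
      α ^ n           ∎)))
    where open import Relation.Binary.Reasoning.Setoid setoid

module OddPrime (K h : ℕ) (p-prime : Prime (suc (2 ℕ.* h))) where

  p : ℕ
  p = suc (2 ℕ.* h)

  instance
    h≢0 : NonZero h
    h≢0 = prime[1+2h]⇒nonZero p-prime

  open Modular (suc (2 ℕ.* h)) using (_≡ₘ_; ≡ₘ-reflexive; ≡ₘ-by-multiples)
  open KFibRing K (suc (2 ℕ.* h))
    using (⟨_,_⟩; α; α⁻¹; α⁻¹⊛α≈𝟏; ι≡; characteristic; α^N≈𝟏⇒period; commutativeSemiring)
  open CommutativeSemiring commutativeSemiring hiding (zero)
  open import Algebra.Properties.Semiring.Exp semiring using (_^_; ^-congˡ; ^-congʳ; ^-homo-*; ^-assocʳ)
  open import Algebra.Properties.CommutativeSemiring.Exp commutativeSemiring using (^-distrib-*)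
  open import Algebra.Properties.Semiring.Mult semiring using (×1-homo-*)
  open CommutativeSemiringProperties commutativeSemiring
  open Characteristic p-prime characteristic
  open import Relation.Binary.Reasoning.Setoid setoid

  D : ℕ
  D = K ℕ.* K ℕ.+ 4

  φ : Carrier → Carrier
  φ x = x ^ p

  -- s = 2α − K, as 2h ≡ −1 (mod p).
  s : Carrier
  s = ⟨ 2 ℕ.* h ℕ.* K , 2 ⟩

  ι2*α≈ιK+s : ι 2 * α ≈ ι K + s
  ι2*α≈ιK+s rewrite ι≡ K =
    ≡ₘ-by-multiples K 0 (solve (K ∷ h ∷ [])) , ≡ₘ-reflexive (solve (K ∷ []))

  s*s≈ιD : s * s ≈ ι D
  s*s≈ιD rewrite ι≡ D =
    ≡ₘ-by-multiples (K ℕ.* K) (K ℕ.* K ℕ.* (2 ℕ.* h)) (solve (K ∷ h ∷ [])) ,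
    ≡ₘ-by-multiples 0 (4 ℕ.* K) (solve (K ∷ h ∷ []))

  ι2-cancel : ∀ {x y} → ι 2 * x ≈ ι 2 * y → x ≈ y
  ι2-cancel = *-cancelˡ-unit (begin
    ι (suc h) * ι 2   ≈⟨ ×1-homo-* (suc h) 2 ⟨
    ι (suc h ℕ.* 2)   ≈⟨ ι-cong-mod [1+h]*2≡ₘ1 ⟩
    ι 1               ≈⟨ +-identityʳ 1# ⟩
    1#                ∎)
    where
    [1+h]*2≡ₘ1 : suc h ℕ.* 2 ≡ₘ 1
    [1+h]*2≡ₘ1 = ≡ₘ-by-multiples 0 1 (solve (h ∷ []))

  φ-affine : ∀ {x y} → ι 2 * x ≈ ι K + y → ι 2 * φ x ≈ ι K + φ y
  φ-affine {x} {y} 2x≈K+y = begin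
    ι 2 * φ x        ≈⟨ *-congʳ (fermat 2) ⟨
    φ (ι 2) * φ x    ≈⟨ ^-distrib-* (ι 2) x p ⟨
    φ (ι 2 * x)      ≈⟨ ^-congˡ p 2x≈K+y ⟩
    φ (ι K + y)      ≈⟨ frobenius-+ (ι K) y ⟩
    φ (ι K) + φ y    ≈⟨ +-congʳ (fermat K) ⟩
    ι K + φ y        ∎

  φ-fixes-ι^ : ∀ n k → φ (ι n ^ k) ≈ ι n ^ k
  φ-fixes-ι^ n k = begin
    φ (ι n ^ k)      ≈⟨ ^-congˡ p (ι-homo-^ n k) ⟩
    φ (ι (n ℕ.^ k))  ≈⟨ fermat (n ℕ.^ k) ⟩
    ι (n ℕ.^ k)      ≈⟨ ι-homo-^ n k ⟨
    ι n ^ k          ∎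

  φs≈s*ιD^h : φ s ≈ s * ι D ^ h
  φs≈s*ιD^h = ^-odd h s*s≈ιD

  α-order : ∀ k N → k ℕ.+ N ≡ p ℕ.* p → φ (φ α) ≈ α ^ k → α ^ N ≈ 1#
  α-order k N k+N≡p*p φφα≈α^k = ^-cancel {u = α⁻¹} k N α⁻¹⊛α≈𝟏 (begin
    α ^ (k ℕ.+ N)   ≡⟨ ≡.cong (α ^_) k+N≡p*p ⟩
    α ^ (p ℕ.* p)   ≈⟨ ^-assocʳ α p p ⟨
    φ (φ α)         ≈⟨ φφα≈α^k ⟩
    α ^ k           ∎)

  ramified-order : p ∣ D → α ^ (p ℕ.* (2 ℕ.* h)) ≈ 1#
  ramified-order p∣D =
    α-order p (p ℕ.* (2 ℕ.* h)) (≡.sym (ℕ.*-suc p (2 ℕ.* h))) (ι2-cancel (begin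
    ι 2 * φ (φ α)   ≈⟨ φ-affine (φ-affine ι2*α≈ιK+s) ⟩
    ι K + φ (φ s)   ≈⟨ +-congˡ (trans (^-congˡ p φs≈0) (0#^n≈0# p)) ⟩
    ι K + 0#        ≈⟨ +-congˡ φs≈0 ⟨
    ι K + φ s       ≈⟨ φ-affine ι2*α≈ιK+s ⟨
    ι 2 * φ α       ∎))
    where
    φs≈0 : φ s ≈ 0#
    φs≈0 = begin
      φ s             ≈⟨ φs≈s*ιD^h ⟩
      s * ι D ^ h     ≈⟨ *-congˡ (^-congˡ h (ι-vanishes p∣D)) ⟩
      s * 0# ^ h      ≈⟨ *-congˡ (0#^n≈0# h) ⟩
      s * 0#          ≈⟨ zeroʳ s ⟩
      0#              ∎

  -- ι D ^ h is the Legendre symbol of D; only its square is needed.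
  ιD^h*ιD^h≈1 : ¬ p ∣ D → ι D ^ h * ι D ^ h ≈ 1#
  ιD^h*ιD^h≈1 p∤D with ι-unit p∤D
  ... | u , u*D≈1 = *-cancelˡ-unit u*D≈1 (begin
    ι D * (ι D ^ h * ι D ^ h)          ≈⟨ *-congˡ (*-congˡ (^-congʳ (ι D) (ℕ.+-identityʳ h))) ⟨
    ι D * (ι D ^ h * ι D ^ (h ℕ.+ 0))  ≈⟨ *-congˡ (^-homo-* (ι D) h (h ℕ.+ 0)) ⟨
    ι D ^ p                            ≈⟨ fermat D ⟩
    ι D                                ≈⟨ *-identityʳ (ι D) ⟨
    ι D * 1#                           ∎)

  φφs≈s : ¬ p ∣ D → φ (φ s) ≈ s
  φφs≈s p∤D = begin
    φ (φ s)               ≈⟨ ^-congˡ p φs≈s*ιD^h ⟩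
    φ (s * e)             ≈⟨ ^-distrib-* s e p ⟩
    φ s * φ e             ≈⟨ *-cong φs≈s*ιD^h (φ-fixes-ι^ D h) ⟩
    s * e * e             ≈⟨ *-assoc s e e ⟩
    s * (e * e)           ≈⟨ *-congˡ (ιD^h*ιD^h≈1 p∤D) ⟩
    s * 1#                ≈⟨ *-identityʳ s ⟩
    s                     ∎
    where
    e = ι D ^ h

  unramified-order : ¬ p ∣ D → α ^ (2 ℕ.* h ℕ.* (2 ℕ.* suc h)) ≈ 1#
  unramified-order p∤D = α-order 1 (2 ℕ.* h ℕ.* (2 ℕ.* suc h)) 1+N≡p*p (ι2-cancel (begin
    ι 2 * φ (φ α)   ≈⟨ φ-affine (φ-affine ι2*α≈ιK+s) ⟩
    ι K + φ (φ s)   ≈⟨ +-congˡ (φφs≈s p∤D) ⟩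
    ι K + s         ≈⟨ ι2*α≈ιK+s ⟨
    ι 2 * α         ≈⟨ *-congˡ {ι 2} (*-identityʳ α) ⟨
    ι 2 * α ^ 1     ∎))
    where
    1+N≡p*p : 1 ℕ.+ 2 ℕ.* h ℕ.* (2 ℕ.* suc h) ≡ suc (2 ℕ.* h) ℕ.* suc (2 ℕ.* h)
    1+N≡p*p = solve (h ∷ [])

  pisano∣p[p∸1] : ∀ {t} → IsPisano K p t → p ∣ D → t ∣ p ℕ.* (2 ℕ.* h)
  pisano∣p[p∸1] t-pisano p∣D = pisano∣period t-pisano (α^N≈𝟏⇒period (ramified-order p∣D))

  pisano∣p²∸1 : ∀ {t} → IsPisano K p t → ¬ p ∣ D → t ∣ 2 ℕ.* h ℕ.* (2 ℕ.* suc h)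
  pisano∣p²∸1 t-pisano p∤D = pisano∣period t-pisano (α^N≈𝟏⇒period (unramified-order p∤D))

open import Data.Nat.Base using (_+_; _*_)
open import Data.Nat.Divisibility using (_∣?_)
open import Data.Product using (_×_)
open import Relation.Nullary using (yes; no)

theorem2p11 : (K p : ℕ) → 1 ≤ K → Prime p → ¬ (2 ≡ p) →
    .{{_ : NonZero p}} → (t : ℕ) → IsPisano K p t →
    (q : ℕ) → Prime q → q ∣ t →
    (q ≤ p) × (q ≡ p → p ∣ K * K + 4)
theorem2p11 K p _ p-prime 2≢p t t-pisano q q-prime q∣t
  with prime≢2⇒odd p-prime 2≢p | p ∣? K * K + 4
... | h , ≡.refl | yes p∣D = q≤p , λ _ → p∣D
  where
  open OddPrime K h p-prime using (h≢0; pisano∣p[p∸1])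
  q≤p : q ≤ suc (2 * h)
  q≤p = prime∣p[p∸1]⇒≤p q-prime (∣-trans q∣t (pisano∣p[p∸1] t-pisano p∣D))
... | h , ≡.refl | no p∤D = ℕ.<⇒≤ q<p , λ q≡p → contradiction q≡p (ℕ.<⇒≢ q<p)
  where
  open OddPrime K h p-prime using (h≢0; pisano∣p²∸1)
  q<p : q < suc (2 * h)
  q<p = prime∣p²∸1⇒<p q-prime (∣-trans q∣t (pisano∣p²∸1 t-pisano p∤D))
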